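{- Let $w\in\mathfrak S_n$. The row reading word of the row-interval filling of the Rothe diagram $\mathbb D(w)$ is precisely the super-Yamanouchi reduced word for $w$.
   Context: $s_i$ is the simple transposition of $\mathfrak S_n$; acting on a permutation in one-line notation it exchanges the entries in positions $i$ and $i+1$. $\ell(w)$ is the number of pairs $i<j$ with $w_i>w_j$. A reduced word for $w$ is a sequence $\rho=(\rho_\ell,\ldots,\rho_1)$, $\ell=\ell(w)$, with $w=s_{\rho_\ell}\cdots s_{\rho_1}\cdot\mathrm{id}$. The runs of $\rho$ are the maximal consecutive segments strictly increasing read left to right, listed $(\rho^{(k)}\mid\cdots\mid\rho^{(1)})$ from left to right; $\rho$ is super-Yamanouchi if every run consists of consecutive integers and $\min(\rho^{(k)})>\cdots>\min(\rho^{(1)})$ (there is a unique such reduced word for each $w$). The Rothe diagram $\mathbb D(w)$ is the set of cells $\{(i,w_j)\mid i<j,\ w_i>w_j\}$, where the cell $(i,w_j)$ lies in row $i$ (rows numbered from bottom to top) and column $w_j$ (columns numbered left to right). The row-interval filling of $\mathbb D(w)$ places, in each row $i$, the entries $i,i+1,i+2,\ldots$ in its cells from left to right. The row reading word of a filling is obtained by reading each row from left to right, starting with the highest row and proceeding downward; the resulting sequence, written left to right, is compared with $(\rho_\ell,\ldots,\rho_1)$. -}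

module Defs where

open import Data.Nat using (ℕ; zero; suc; _+_; _∸_; _<_; _≤_; _>_; _<ᵇ_; _≡ᵇ_; _⊓_)
open import Data.Bool using (Bool; _∧_)
open import Data.List using (List; []; _∷_; map; upTo; length; filterᵇ; concatMap; reverse; foldr)
open import Data.Nat.ListAction using (sum)
open import Data.Bool.ListAction using (any)
open import Data.List.Relation.Unary.All using (All)
open import Data.List.Relation.Unary.Linked using (Linked)
open import Data.Product using (_×_)
open import Data.Unit using (⊤)
open import Relation.Binary.PropositionalEquality using (_≡_)

-- Permutations in one-line notation: a list w = (w_1, ..., w_n) of the values 1..n.
-- Positions are 1-indexed.

range : ℕ → ℕ → List ℕ
range a b = map (a +_) (upTo (suc b ∸ a))

idPerm : ℕ → List ℕ
idPerm n = range 1 n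

-- w_i (1-indexed); returns 0 outside positions 1..n
at : List ℕ → ℕ → ℕ
at [] _ = 0
at (x ∷ xs) zero = 0
at (x ∷ xs) (suc zero) = x
at (x ∷ xs) (suc (suc i)) = at xs (suc i)

-- s_i acting on one-line notation: exchange the entries in positions i and i+1
swapAt : ℕ → List ℕ → List ℕ
swapAt (suc zero) (x ∷ y ∷ xs) = y ∷ x ∷ xs
swapAt (suc (suc i)) (x ∷ xs) = x ∷ swapAt (suc i) xs
swapAt _ xs = xs

-- the word (ρ_ℓ, ..., ρ_1), listed left to right, acting as s_{ρ_ℓ} ⋯ s_{ρ_1} · v
act : List ℕ → List ℕ → List ℕ
act ρ v = foldr swapAt v ρ

inversions : List ℕ → ℕ
inversions w = sum (map (λ i → length (filterᵇ (λ j → (i <ᵇ j) ∧ (at w j <ᵇ at w i)) (range 1 n))) (range 1 n))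
  where n = length w

IsReducedWord : ℕ → List ℕ → List ℕ → Set
IsReducedWord n w ρ =
  All (λ r → 1 ≤ r × r < n) ρ × act ρ (idPerm n) ≡ w × length ρ ≡ inversions w

-- runs: maximal strictly increasing consecutive segments, listed left to right
runs : List ℕ → List (List ℕ)
runs [] = []
runs (x ∷ xs) = addTo (runs xs)
  where
  addTo : List (List ℕ) → List (List ℕ)
  addTo ((y ∷ r) ∷ rs) with x <ᵇ y
  ... | Bool.true = (x ∷ y ∷ r) ∷ rs
  ... | Bool.false = (x ∷ []) ∷ (y ∷ r) ∷ rs
  addTo rs = (x ∷ []) ∷ rs

minL : List ℕ → ℕ
minL [] = 0
minL (x ∷ xs) = foldr _⊓_ x xs

Consecutive : List ℕ → Set
Consecutive [] = ⊤
Consecutive (x ∷ []) = ⊤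
Consecutive (x ∷ y ∷ r) = y ≡ suc x × Consecutive (y ∷ r)

-- super-Yamanouchi: all runs consecutive, and min ρ^(k) > ... > min ρ^(1)
-- (runs listed left to right as ρ^(k), ..., ρ^(1))
SuperYamanouchi : List ℕ → Set
SuperYamanouchi ρ = All Consecutive (runs ρ) × Linked _>_ (map minL (runs ρ))

inDiagram : List ℕ → ℕ → ℕ → Bool
inDiagram w i c = any (λ j → (i <ᵇ j) ∧ ((at w j <ᵇ at w i) ∧ (at w j ≡ᵇ c))) (range 1 (length w))

-- row-interval filling: the cell (i , c) of row i receives i + (number of cells of row i left of c),
-- i.e. the entries i, i+1, i+2, ... from left to right
rowIntervalFill : List ℕ → ℕ → ℕ → ℕ
rowIntervalFill w i c = i + length (filterᵇ (λ c' → (c' <ᵇ c) ∧ inDiagram w i c') (range 1 (length w)))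

rowReadingWord : List ℕ → List ℕ
rowReadingWord w =
  concatMap (λ i → map (rowIntervalFill w i) (filterᵇ (inDiagram w i) (range 1 n)))
            (reverse (range 1 n))
  where n = length w

-- Row i of 𝔻(w) has c_i = #{j > i : w_j < w_i} cells, (c_1, …, c_n) being the Lehmer code
-- of w, so its row-interval filling reads i, i+1, …, i+c_i-1 and the row reading word is
--     codeWord 0 (c_1, …, c_n) = [n, n+c_n) ⋯ [2, 2+c_2) [1, 1+c_1)      (rowReadingWord≡codeWord).
-- After general facts on counting in lists and on integer intervals, the file develops the
-- Lehmer code and this identity, and then shows that the word of the Lehmer code
--   * has letters in [1, n) and length ∑ c_i = ℓ(w)          (inversions≡sum-lehmerCode),
--   * produces w: its bottom row s_1 ⋯ s_{c_1} brings w_1 to the front and the rows above act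
--     on the remaining entries, by induction                  (act-codeWord),
--   * is super-Yamanouchi: its runs are its nonempty rows, intervals of consecutive letters
--     with decreasing first letters                            (codeWord-superYamanouchi).
-- The proposition is the combination of these facts.

module Submission where

open import Defs
open import Data.Nat using (ℕ)
open import Data.List using (List)
open import Data.List.Relation.Binary.Permutation.Propositional using (_↭_)
open import Data.Product using (_×_)

open import Data.Nat using (zero; suc; _+_; _≤_; _<_; _>_; _<ᵇ_; _≡ᵇ_; _⊓_; s≤s)
open import Data.Nat.Properties
open import Data.Nat.ListAction using (sum)
open import Data.Bool using (Bool; true; false; _∧_; _∨_; if_then_else_; T)
open import Data.Bool.Properties using (T-≡; ∧-zeroʳ)
open import Data.Bool.ListAction using (any)
open import Data.Empty using (⊥-elim)
open import Data.List using ([]; _∷_; applyUpTo; _++_; [_]; map; length; filterᵇ; concatMap; reverse; drop; foldr)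
import Data.List.Properties as List
open import Data.List.Relation.Unary.All using (All; []; _∷_)
import Data.List.Relation.Unary.All as All
import Data.List.Relation.Unary.All.Properties as All
open import Data.List.Relation.Unary.AllPairs using (AllPairs; []; _∷_)
import Data.List.Relation.Unary.AllPairs as AllPairs
import Data.List.Relation.Unary.AllPairs.Properties as AllPairs
open import Data.List.Relation.Unary.Linked using (Linked; []; [-]; _∷_)
open import Data.List.Relation.Unary.Unique.Propositional using (Unique)
open import Data.List.Relation.Unary.Any using (here)
open import Data.List.Membership.Propositional.Properties using (∈-∃++)
open import Data.List.Relation.Binary.Permutation.Propositional using (↭-sym; ↭⇒↭ₛ)
open import Data.List.Relation.Binary.Permutation.Propositional.Properties
  using (↭-length; filter-↭; All-resp-↭; ∈-resp-↭; drop-mid)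
import Data.List.Relation.Binary.Permutation.Setoid.Properties as Permutationₛ
open import Data.Product using (_,_; proj₁; proj₂; ∃₂)
open import Data.Sum using (inj₁; inj₂)
open import Function using (Equivalence; _∘_)
open import Relation.Nullary using (¬_; yes; no)
open import Relation.Nullary.Decidable using (T?)
open import Relation.Binary.PropositionalEquality hiding ([_])

T⇒≡true : ∀ {b} → T b → b ≡ true
T⇒≡true = Equivalence.to T-≡

¬T⇒≡false : ∀ {b} → ¬ T b → b ≡ false
¬T⇒≡false {false} _  = refl
¬T⇒≡false {true}  ¬t = ⊥-elim (¬t _)

<ᵇ-true : ∀ {m n} → m < n → (m <ᵇ n) ≡ true
<ᵇ-true m<n = T⇒≡true (<⇒<ᵇ m<n)

<ᵇ-false : ∀ {m n} → n ≤ m → (m <ᵇ n) ≡ false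
<ᵇ-false {m} {n} n≤m = ¬T⇒≡false (λ t → <⇒≱ (<ᵇ⇒< m n t) n≤m)

≡ᵇ-refl : ∀ m → (m ≡ᵇ m) ≡ true
≡ᵇ-refl m = T⇒≡true (≡⇒≡ᵇ m m refl)

≡ᵇ-false : ∀ {m n} → m ≢ n → (m ≡ᵇ n) ≡ false
≡ᵇ-false {m} {n} m≢n = ¬T⇒≡false (λ t → m≢n (≡ᵇ⇒≡ m n t))

count : (ℕ → Bool) → List ℕ → ℕ
count p xs = length (filterᵇ p xs)

filterᵇ-accept : ∀ (p : ℕ → Bool) x xs → p x ≡ true → filterᵇ p (x ∷ xs) ≡ x ∷ filterᵇ p xs
filterᵇ-accept p x xs px rewrite px = refl

filterᵇ-reject : ∀ (p : ℕ → Bool) x xs → p x ≡ false → filterᵇ p (x ∷ xs) ≡ filterᵇ p xs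
filterᵇ-reject p x xs px rewrite px = refl

count-accept : ∀ (p : ℕ → Bool) x xs → p x ≡ true → count p (x ∷ xs) ≡ suc (count p xs)
count-accept p x xs px rewrite px = refl

count-reject : ∀ (p : ℕ → Bool) x xs → p x ≡ false → count p (x ∷ xs) ≡ count p xs
count-reject p x xs px rewrite px = refl

count-cong : ∀ {p q} → (∀ c → p c ≡ q c) → ∀ xs → count p xs ≡ count q xs
count-cong p≗q [] = refl
count-cong {p} {q} p≗q (x ∷ xs) rewrite p≗q x with q x
... | true  = cong suc (count-cong p≗q xs)
... | false = count-cong p≗q xs

count-none : ∀ {p} xs → All (λ c → p c ≡ false) xs → count p xs ≡ 0
count-none []       []         = refl
count-none {p} (x ∷ xs) (px ∷ pxs) = trans (count-reject p x xs px) (count-none xs pxs)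

count-all : ∀ {p} xs → All (λ c → p c ≡ true) xs → count p xs ≡ length xs
count-all []       []         = refl
count-all {p} (x ∷ xs) (px ∷ pxs) = trans (count-accept p x xs px) (cong suc (count-all xs pxs))

count-++ : ∀ p xs ys → count p (xs ++ ys) ≡ count p xs + count p ys
count-++ p xs ys = trans (cong length (List.filter-++ (T? ∘ p) xs ys)) (List.length-++ (filterᵇ p xs))

count-≤ : ∀ p xs → count p xs ≤ length xs
count-≤ p = List.length-filter (T? ∘ p)

count-map : ∀ p (f : ℕ → ℕ) xs → count p (map f xs) ≡ count (p ∘ f) xs
count-map p f []       = refl
count-map p f (x ∷ xs) with p (f x)
... | true  = cong suc (count-map p f xs)
... | false = count-map p f xs

count-↭ : ∀ p {xs ys} → xs ↭ ys → count p xs ≡ count p ys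
count-↭ p xs↭ys = ↭-length (filter-↭ (T? ∘ p) xs↭ys)

count-∨ : ∀ (a b : ℕ → Bool) → (∀ c → (a c ∧ b c) ≡ false) →
          ∀ xs → count (λ c → a c ∨ b c) xs ≡ count a xs + count b xs
count-∨ a b disjoint []       = refl
count-∨ a b disjoint (x ∷ xs) with a x | b x | disjoint x
... | true  | true  | ()
... | true  | false | _ = cong suc (count-∨ a b disjoint xs)
... | false | true  | _ = trans (cong suc (count-∨ a b disjoint xs)) (sym (+-suc _ _))
... | false | false | _ = count-∨ a b disjoint xs

any≡count>0 : ∀ p xs → any p xs ≡ (0 <ᵇ count p xs)
any≡count>0 p []       = refl
any≡count>0 p (x ∷ xs) with p x
... | true  = refl
... | false = any≡count>0 p xs

interval : ℕ → ℕ → List ℕ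
interval a zero    = []
interval a (suc m) = a ∷ interval (suc a) m

Sorted : List ℕ → Set
Sorted = AllPairs _<_

interval-suc : ∀ a m → interval (suc a) m ≡ map suc (interval a m)
interval-suc a zero    = refl
interval-suc a (suc m) = cong (suc a ∷_) (interval-suc (suc a) m)

length-interval : ∀ a m → length (interval a m) ≡ m
length-interval a zero    = refl
length-interval a (suc m) = cong suc (length-interval (suc a) m)

interval-bounds : ∀ a m → All (λ y → a ≤ y × y < a + m) (interval a m)
interval-bounds a zero    = []
interval-bounds a (suc m) =
  (≤-refl , subst (a <_) (sym (+-suc a m)) (s≤s (m≤m+n a m)))
  ∷ All.map (λ {y} (a<y , y<a+m) → <⇒≤ a<y , subst (y <_) (sym (+-suc a m)) y<a+m)
            (interval-bounds (suc a) m)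

interval-sorted : ∀ a m → Sorted (interval a m)
interval-sorted a zero    = []
interval-sorted a (suc m) = All.map proj₁ (interval-bounds (suc a) m) ∷ interval-sorted (suc a) m

range1≡interval : ∀ n → range 1 n ≡ interval 1 n
range1≡interval n = trans (List.map-upTo suc n) (applyUpTo≡interval n suc 1 (λ _ → refl))
  where
  applyUpTo≡interval : ∀ m (f : ℕ → ℕ) a → (∀ k → f k ≡ a + k) → applyUpTo f m ≡ interval a m
  applyUpTo≡interval zero    f a f≗a+ = refl
  applyUpTo≡interval (suc m) f a f≗a+ =
    cong₂ _∷_ (trans (f≗a+ 0) (+-identityʳ a))
              (applyUpTo≡interval m (f ∘ suc) (suc a) (λ k → trans (f≗a+ (suc k)) (+-suc a k)))

map-interval-suc : ∀ (f : ℕ → ℕ) a m → map f (interval (suc a) m) ≡ map (f ∘ suc) (interval a m)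
map-interval-suc f a m = trans (cong (map f) (interval-suc a m)) (sym (List.map-∘ (interval a m)))

count-interval-suc : ∀ p a m → count p (interval (suc a) m) ≡ count (p ∘ suc) (interval a m)
count-interval-suc p a m = trans (cong (count p) (interval-suc a m)) (count-map p suc (interval a m))

count-≡ᵇ-interval : ∀ {y} a m → a ≤ y → y < a + m → count (y ≡ᵇ_) (interval a m) ≡ 1
count-≡ᵇ-interval a zero    a≤y y<a = ⊥-elim (<⇒≱ (subst (_ <_) (+-identityʳ a) y<a) a≤y)
count-≡ᵇ-interval {y} a (suc m) a≤y y<a+m with m≤n⇒m<n∨m≡n a≤y
... | inj₂ refl = trans (count-accept (y ≡ᵇ_) y _ (≡ᵇ-refl y))
                        (cong suc (count-none _ (All.map (λ (y<z , _) → ≡ᵇ-false (<⇒≢ y<z))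
                                                          (interval-bounds (suc y) m))))
... | inj₁ a<y  = trans (count-reject (y ≡ᵇ_) a _ (≡ᵇ-false (≢-sym (<⇒≢ a<y))))
                        (count-≡ᵇ-interval (suc a) m a<y (subst (y <_) (+-suc a m) y<a+m))

-- From positions to values.  Position j of w holds at w j; the entries after position i form
-- drop i w.  So counting positions j > i by a property of w_j counts drop i w by that property.

-- The same count over 0-based indices k (position k+1); this form follows the recursion on w.
count-after₀ : ∀ w i g → count (λ k → (i <ᵇ suc k) ∧ g (at w (suc k))) (interval 0 (length w))
                        ≡ count g (drop i w)
count-after₀ []       zero    g = refl
count-after₀ []       (suc i) g = refl
count-after₀ (x ∷ xs) zero    g with g x
... | true  = cong suc (trans (count-interval-suc _ 0 (length xs)) (count-after₀ xs zero g))
... | false = trans (count-interval-suc _ 0 (length xs)) (count-after₀ xs zero g)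
count-after₀ (x ∷ xs) (suc i) g = trans (count-interval-suc _ 0 (length xs)) (count-after₀ xs i g)

count-after : ∀ w i g → count (λ j → (i <ᵇ j) ∧ g (at w j)) (range 1 (length w)) ≡ count g (drop i w)
count-after w i g = begin
  count P (range 1 n)             ≡⟨ cong (count P) (range1≡interval n) ⟩
  count P (interval 1 n)          ≡⟨ count-interval-suc P 0 n ⟩
  count (P ∘ suc) (interval 0 n)  ≡⟨ count-after₀ w i g ⟩
  count g (drop i w)              ∎
  where
  open ≡-Reasoning
  n = length w
  P : ℕ → Bool
  P j = (i <ᵇ j) ∧ g (at w j)

any-after : ∀ w i g → any (λ j → (i <ᵇ j) ∧ g (at w j)) (range 1 (length w)) ≡ any g (drop i w)
any-after w i g = trans (any≡count>0 _ (range 1 (length w)))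
                 (trans (cong (0 <ᵇ_) (count-after w i g)) (sym (any≡count>0 g (drop i w))))

-- The Lehmer code of w: its i-th entry c_i = #{j > i : w_j < w_i} is the number of cells in
-- row i of the Rothe diagram.
lehmerAt : List ℕ → ℕ → ℕ
lehmerAt w i = count (_<ᵇ at w i) (drop i w)

lehmerCode : List ℕ → List ℕ
lehmerCode []       = []
lehmerCode (x ∷ xs) = count (_<ᵇ x) xs ∷ lehmerCode xs

lehmerCode-positions : ∀ w → map (lehmerAt w) (range 1 (length w)) ≡ lehmerCode w
lehmerCode-positions w = begin
  map (lehmerAt w) (range 1 n)              ≡⟨ cong (map (lehmerAt w)) (range1≡interval n) ⟩
  map (lehmerAt w) (interval 1 n)           ≡⟨ map-interval-suc (lehmerAt w) 0 n ⟩
  map (lehmerAt w ∘ suc) (interval 0 n)     ≡⟨ from0 w ⟩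
  lehmerCode w                              ∎
  where
  open ≡-Reasoning
  n = length w
  from0 : ∀ v → map (lehmerAt v ∘ suc) (interval 0 (length v)) ≡ lehmerCode v
  from0 []       = refl
  from0 (x ∷ xs) = cong (count (_<ᵇ x) xs ∷_) (trans (map-interval-suc _ 0 (length xs)) (from0 xs))

inversions≡sum-lehmerCode : ∀ w → inversions w ≡ sum (lehmerCode w)
inversions≡sum-lehmerCode w = begin
  inversions w              ≡⟨ cong sum (List.map-cong (λ i → count-after w i (_<ᵇ at w i)) R) ⟩
  sum (map (lehmerAt w) R)  ≡⟨ cong sum (lehmerCode-positions w) ⟩
  sum (lehmerCode w)        ∎
  where
  open ≡-Reasoning
  R = range 1 (length w)

-- The word of a code (c_1, …, c_m) at offset p: reading rows from the top (row p+m) down to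
-- row p+1, where row p+k contributes the interval [p+k, p+k+c_k).  For p = 0 and the Lehmer
-- code of w this is the row reading word of the row-interval filling of 𝔻(w).
codeWord : ℕ → List ℕ → List ℕ
codeWord p []       = []
codeWord p (c ∷ cs) = codeWord (suc p) cs ++ interval (suc p) c

codeWord-rows : ∀ (f : ℕ → ℕ) p m →
  concatMap (λ i → interval i (f i)) (reverse (interval (suc p) m)) ≡ codeWord p (map f (interval (suc p) m))
codeWord-rows f p zero    = refl
codeWord-rows f p (suc m) = begin
  concatMap row (reverse (suc p ∷ I))              ≡⟨ cong (concatMap row) (List.unfold-reverse (suc p) I) ⟩
  concatMap row (reverse I ++ [ suc p ])           ≡⟨ List.concatMap-++ row (reverse I) [ suc p ] ⟩
  concatMap row (reverse I) ++ row (suc p) ++ []   ≡⟨ cong₂ _++_ (codeWord-rows f (suc p) m) (List.++-identityʳ _) ⟩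
  codeWord (suc p) (map f I) ++ row (suc p)        ∎
  where
  open ≡-Reasoning
  I = interval (suc (suc p)) m
  row : ℕ → List ℕ
  row i = interval i (f i)

length-codeWord : ∀ p cs → length (codeWord p cs) ≡ sum cs
length-codeWord p []       = refl
length-codeWord p (c ∷ cs) = begin
  length (codeWord (suc p) cs ++ interval (suc p) c)              ≡⟨ List.length-++ (codeWord (suc p) cs) ⟩
  length (codeWord (suc p) cs) + length (interval (suc p) c)      ≡⟨ cong₂ _+_ (length-codeWord (suc p) cs) (length-interval (suc p) c) ⟩
  sum cs + c                                                      ≡⟨ +-comm (sum cs) c ⟩
  c + sum cs                                                      ∎
  where open ≡-Reasoning

codeWord-suc : ∀ p cs → codeWord (suc p) cs ≡ map suc (codeWord p cs)
codeWord-suc p []       = refl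
codeWord-suc p (c ∷ cs) =
  trans (cong₂ _++_ (codeWord-suc (suc p) cs) (interval-suc (suc p) c))
        (sym (List.map-++ suc (codeWord (suc p) cs) (interval (suc p) c)))

codeWord-above : ∀ p cs → All (p <_) (codeWord p cs)
codeWord-above p []       = []
codeWord-above p (c ∷ cs) =
  All.++⁺ (All.map <⇒≤ (codeWord-above (suc p) cs)) (All.map proj₁ (interval-bounds (suc p) c))

-- For a Lehmer code the letters stay below p + n, since c_i ≤ n - i.
lehmerWord-below : ∀ p w → All (_< p + length w) (codeWord p (lehmerCode w))
lehmerWord-below p []       = []
lehmerWord-below p (x ∷ xs) =
  subst (λ b → All (_< b) (codeWord p (lehmerCode (x ∷ xs)))) (sym (+-suc p (length xs)))
  (All.++⁺ (lehmerWord-below (suc p) xs)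
           (All.map (λ (_ , y<) → <-≤-trans y< (+-monoʳ-≤ (suc p) (count-≤ (_<ᵇ x) xs)))
                    (interval-bounds (suc p) (count (_<ᵇ x) xs))))

leftOf : (ℕ → Bool) → ℕ → ℕ → Bool
leftOf P c c′ = (c′ <ᵇ c) ∧ P c′

count-leftOf-none : ∀ P c R → All (c ≤_) R → count (leftOf P c) R ≡ 0
count-leftOf-none P c R c≤R = count-none R (All.map (λ {c′} c≤c′ → cong (_∧ P c′) (<ᵇ-false c≤c′)) c≤R)

leftOf-selected : ∀ P {x c} → x < c → leftOf P c x ≡ P x
leftOf-selected P {x} x<c = cong (_∧ P x) (<ᵇ-true x<c)

-- Labelling the cells selected by P in a sorted list R by b + (number of selected cells to
-- their left) produces the labels b, b+1, b+2, …: this is the row-interval filling of one row.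
fill-sorted : ∀ R → Sorted R → ∀ b P →
  map (λ c → b + count (leftOf P c) R) (filterᵇ P R) ≡ interval b (count P R)
fill-sorted []      []             b P = refl
fill-sorted (x ∷ R) (x<R ∷ sorted) b P = fill-cons (P x) refl
  where
  open ≡-Reasoning
  label : ℕ → List ℕ → ℕ → ℕ
  label b′ S c = b′ + count (leftOf P c) S

  selected-right : All (x <_) (filterᵇ P R)
  selected-right = All.filter⁺ (T? ∘ P) x<R

  fill-cons : ∀ bx → P x ≡ bx → map (label b (x ∷ R)) (filterᵇ P (x ∷ R)) ≡ interval b (count P (x ∷ R))
  fill-cons true Px = begin
    map (label b (x ∷ R)) (filterᵇ P (x ∷ R))                ≡⟨ cong (map (label b (x ∷ R))) (filterᵇ-accept P x R Px) ⟩
    label b (x ∷ R) x ∷ map (label b (x ∷ R)) (filterᵇ P R)   ≡⟨ cong₂ _∷_ first (List.map-cong-local (All.map shifted selected-right)) ⟩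
    b ∷ map (label (suc b) R) (filterᵇ P R)                   ≡⟨ cong (b ∷_) (fill-sorted R sorted (suc b) P) ⟩
    interval b (suc (count P R))                               ≡⟨ cong (interval b) (sym (count-accept P x R Px)) ⟩
    interval b (count P (x ∷ R))                               ∎
    where
    first : label b (x ∷ R) x ≡ b
    first = trans (cong (b +_) (count-leftOf-none P x (x ∷ R) (≤-refl ∷ All.map <⇒≤ x<R))) (+-identityʳ b)
    shifted : ∀ {c} → x < c → label b (x ∷ R) c ≡ label (suc b) R c
    shifted {c} x<c = trans (cong (b +_) (count-accept (leftOf P c) x R (trans (leftOf-selected P x<c) Px)))
                            (+-suc b _)
  fill-cons false Px = begin
    map (label b (x ∷ R)) (filterᵇ P (x ∷ R))  ≡⟨ cong (map (label b (x ∷ R))) (filterᵇ-reject P x R Px) ⟩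
    map (label b (x ∷ R)) (filterᵇ P R)        ≡⟨ List.map-cong-local (All.map unshifted selected-right) ⟩
    map (label b R) (filterᵇ P R)              ≡⟨ fill-sorted R sorted b P ⟩
    interval b (count P R)                     ≡⟨ cong (interval b) (sym (count-reject P x R Px)) ⟩
    interval b (count P (x ∷ R))               ∎
    where
    unshifted : ∀ {c} → x < c → label b (x ∷ R) c ≡ label b R c
    unshifted {c} x<c = cong (b +_) (count-reject (leftOf P c) x R (trans (leftOf-selected P x<c) Px))

count-matches : ∀ D p A → Unique D → All (λ y → count (y ≡ᵇ_) A ≡ 1) D →
                count (λ c → any (λ y → p y ∧ (y ≡ᵇ c)) D) A ≡ count p D
count-matches []      p A []            []             = count-none A (All.universal (λ _ → refl) A)
count-matches (y ∷ D) p A (y∉D ∷ uniqD) (once ∷ onces) with p y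
... | false = count-matches D p A uniqD onces
... | true  = trans (count-∨ (y ≡ᵇ_) matchD disjoint A) (cong₂ _+_ once (count-matches D p A uniqD onces))
  where
  matchD : ℕ → Bool
  matchD c = any (λ z → p z ∧ (z ≡ᵇ c)) D

  absent : ∀ E → All (y ≢_) E → any (λ z → p z ∧ (z ≡ᵇ y)) E ≡ false
  absent []      []           = refl
  absent (z ∷ E) (y≢z ∷ y∉E) =
    cong₂ _∨_ (trans (cong (p z ∧_) (≡ᵇ-false (≢-sym y≢z))) (∧-zeroʳ (p z))) (absent E y∉E)

  disjoint : ∀ c → ((y ≡ᵇ c) ∧ matchD c) ≡ false
  disjoint c with y ≟ c
  ... | yes refl = trans (cong ((y ≡ᵇ y) ∧_) (absent D y∉D)) (∧-zeroʳ _)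
  ... | no y≢c   = cong (_∧ matchD c) (≡ᵇ-false y≢c)

row-filling : ∀ w → Unique w → All (λ y → 1 ≤ y × y < 1 + length w) w → ∀ i →
  map (rowIntervalFill w i) (filterᵇ (inDiagram w i) (range 1 (length w))) ≡ interval i (lehmerAt w i)
row-filling w uniq bounded i = begin
  map (rowIntervalFill w i) (filterᵇ (inDiagram w i) R)  ≡⟨ fill-sorted R sortedR i (inDiagram w i) ⟩
  interval i (count (inDiagram w i) R)                   ≡⟨ cong (interval i) row-length ⟩
  interval i (lehmerAt w i)                              ∎
  where
  open ≡-Reasoning
  R = range 1 (length w)

  sortedR : Sorted R
  sortedR = subst Sorted (sym (range1≡interval (length w))) (interval-sorted 1 (length w))

  once : All (λ y → count (y ≡ᵇ_) R ≡ 1) w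
  once = All.map (λ (1≤y , y<1+n) → trans (cong (count _) (range1≡interval (length w)))
                                          (count-≡ᵇ-interval 1 (length w) 1≤y y<1+n))
                 bounded

  -- Cell (i, c) lies in 𝔻(w) iff c = w_j < w_i for some j > i, i.e. c ∈ drop i w and c < w_i.
  row-length : count (inDiagram w i) R ≡ lehmerAt w i
  row-length = trans (count-cong (λ c → any-after w i (λ y → (y <ᵇ at w i) ∧ (y ≡ᵇ c))) R)
                     (count-matches (drop i w) (_<ᵇ at w i) R (AllPairs.drop⁺ i uniq) (All.drop⁺ i once))

rowReadingWord≡codeWord : ∀ w → Unique w → All (λ y → 1 ≤ y × y < 1 + length w) w →
                          rowReadingWord w ≡ codeWord 0 (lehmerCode w)
rowReadingWord≡codeWord w uniq bounded = begin
  rowReadingWord w                                               ≡⟨ List.concatMap-cong (row-filling w uniq bounded) (reverse R) ⟩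
  concatMap (λ i → interval i (lehmerAt w i)) (reverse R)        ≡⟨ cong (λ I → concatMap (λ i → interval i (lehmerAt w i)) (reverse I)) (range1≡interval n) ⟩
  concatMap (λ i → interval i (lehmerAt w i)) (reverse (interval 1 n)) ≡⟨ codeWord-rows (lehmerAt w) 0 n ⟩
  codeWord 0 (map (lehmerAt w) (interval 1 n))                   ≡⟨ cong (codeWord 0) (trans (cong (map _) (sym (range1≡interval n))) (lehmerCode-positions w)) ⟩
  codeWord 0 (lehmerCode w)                                      ∎
  where
  open ≡-Reasoning
  n = length w
  R = range 1 n

act-++ : ∀ ρ σ v → act (ρ ++ σ) v ≡ act ρ (act σ v)
act-++ ρ σ v = List.foldr-++ swapAt v ρ σ

act-shift : ∀ ρ a v → All (1 ≤_) ρ → act (map suc ρ) (a ∷ v) ≡ a ∷ act ρ v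
act-shift []          a v []        = refl
act-shift (suc r ∷ ρ) a v (_ ∷ 1≤ρ) = cong (swapAt (suc (suc r))) (act-shift ρ a v 1≤ρ)

bubble : ∀ L x R → act (interval 1 (length L)) (L ++ x ∷ R) ≡ x ∷ L ++ R
bubble []      x R = refl
bubble (l ∷ L) x R = cong (swapAt 1) (begin
  act (interval 2 m) (l ∷ L ++ x ∷ R)          ≡⟨ cong (λ ρ → act ρ (l ∷ L ++ x ∷ R)) (interval-suc 1 m) ⟩
  act (map suc (interval 1 m)) (l ∷ L ++ x ∷ R) ≡⟨ act-shift (interval 1 m) l (L ++ x ∷ R) (All.map proj₁ (interval-bounds 1 m)) ⟩
  l ∷ act (interval 1 m) (L ++ x ∷ R)          ≡⟨ cong (l ∷_) (bubble L x R) ⟩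
  l ∷ x ∷ L ++ R                               ∎)
  where
  open ≡-Reasoning
  m = length L

sorted-split : ∀ L x R → Sorted (L ++ x ∷ R) → All (_< x) L × All (x <_) R × Sorted (L ++ R)
sorted-split []      x R (x<R ∷ sortedR) = [] , x<R , sortedR
sorted-split (l ∷ L) x R (l<LxR ∷ sorted) =
  All.head l<xR ∷ L<x , x<R , All.++⁺ (All.++⁻ˡ L l<LxR) (All.tail l<xR) ∷ sortedLR
  where
  l<xR = All.++⁻ʳ L l<LxR
  split = sorted-split L x R sorted
  L<x = proj₁ split
  x<R = proj₁ (proj₂ split)
  sortedLR = proj₂ (proj₂ split)

-- Acting on the increasing arrangement u of the entries of w, the word of the Lehmer code
-- produces w: its bottom row [1, 1+c_1) brings w_1 to the front, the rest acts on the tail.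
act-codeWord : ∀ w u → Sorted u → w ↭ u → act (codeWord 0 (lehmerCode w)) u ≡ w
act-codeWord []       []      _ _   = refl
act-codeWord []       (_ ∷ _) _ w↭u with () ← ↭-length w↭u
act-codeWord (x ∷ xs) u sorted w↭u with ∈-∃++ (∈-resp-↭ w↭u (here refl))
... | L , R , refl = begin
  act (codeWord 1 cs ++ interval 1 c) (L ++ x ∷ R)                ≡⟨ act-++ (codeWord 1 cs) (interval 1 c) (L ++ x ∷ R) ⟩
  act (codeWord 1 cs) (act (interval 1 c) (L ++ x ∷ R))           ≡⟨ cong (λ k → act (codeWord 1 cs) (act (interval 1 k) (L ++ x ∷ R))) c≡|L| ⟩
  act (codeWord 1 cs) (act (interval 1 (length L)) (L ++ x ∷ R))  ≡⟨ cong (act (codeWord 1 cs)) (bubble L x R) ⟩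
  act (codeWord 1 cs) (x ∷ L ++ R)                                ≡⟨ cong (λ ρ → act ρ (x ∷ L ++ R)) (codeWord-suc 0 cs) ⟩
  act (map suc (codeWord 0 cs)) (x ∷ L ++ R)                      ≡⟨ act-shift (codeWord 0 cs) x (L ++ R) (codeWord-above 0 cs) ⟩
  x ∷ act (codeWord 0 cs) (L ++ R)                                ≡⟨ cong (x ∷_) (act-codeWord xs (L ++ R) sortedLR xs↭LR) ⟩
  x ∷ xs                                                          ∎
  where
  open ≡-Reasoning
  cs = lehmerCode xs
  c = count (_<ᵇ x) xs
  split = sorted-split L x R sorted
  sortedLR = proj₂ (proj₂ split)

  xs↭LR : xs ↭ L ++ R
  xs↭LR = drop-mid [] L w↭u

  -- c_1 counts the entries smaller than w_1, i.e. those before w_1 in u.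
  c≡|L| : c ≡ length L
  c≡|L| = begin
    count (_<ᵇ x) xs                           ≡⟨ count-↭ (_<ᵇ x) xs↭LR ⟩
    count (_<ᵇ x) (L ++ R)                     ≡⟨ count-++ (_<ᵇ x) L R ⟩
    count (_<ᵇ x) L + count (_<ᵇ x) R          ≡⟨ cong₂ _+_ (count-all L (All.map <ᵇ-true (proj₁ split)))
                                                            (count-none R (All.map (λ x<y → <ᵇ-false (<⇒≤ x<y)) (proj₁ (proj₂ split)))) ⟩
    length L + 0                               ≡⟨ +-identityʳ (length L) ⟩
    length L                                   ∎

prependRun : ℕ → List (List ℕ) → List (List ℕ)
prependRun x ((y ∷ r) ∷ rs) = if x <ᵇ y then (x ∷ y ∷ r) ∷ rs else (x ∷ []) ∷ (y ∷ r) ∷ rs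
prependRun x rs             = (x ∷ []) ∷ rs

runs-∷ : ∀ x xs → runs (x ∷ xs) ≡ prependRun x (runs xs)
runs-∷ x xs with runs xs
... | []           = refl
... | [] ∷ rs      = refl
... | (y ∷ r) ∷ rs with x <ᵇ y
...   | true  = refl
...   | false = refl

runs-nonempty : ∀ y r → ∃₂ λ r′ rs → runs (y ∷ r) ≡ (y ∷ r′) ∷ rs
runs-nonempty y r rewrite runs-∷ y r with runs r
... | []           = [] , [] , refl
... | [] ∷ rs      = [] , [] ∷ rs , refl
... | (z ∷ q) ∷ qs with y <ᵇ z
...   | true  = z ∷ q , qs , refl
...   | false = [] , (z ∷ q) ∷ qs , refl

runs-++ : ∀ A b B → All (b ≤_) A → runs (A ++ b ∷ B) ≡ runs A ++ runs (b ∷ B)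
runs-++ []      b B []          = refl
runs-++ (a ∷ A) b B (b≤a ∷ b≤A) = begin
  runs (a ∷ A ++ b ∷ B)                  ≡⟨ runs-∷ a (A ++ b ∷ B) ⟩
  prependRun a (runs (A ++ b ∷ B))       ≡⟨ cong (prependRun a) (runs-++ A b B b≤A) ⟩
  prependRun a (runs A ++ runs (b ∷ B))  ≡⟨ prepend-split A ⟩
  prependRun a (runs A) ++ runs (b ∷ B)  ≡⟨ cong (_++ runs (b ∷ B)) (sym (runs-∷ a A)) ⟩
  runs (a ∷ A) ++ runs (b ∷ B)           ∎
  where
  open ≡-Reasoning
  -- a never joins a run starting at b, since a ≥ b.
  prepend-split : ∀ A′ → prependRun a (runs A′ ++ runs (b ∷ B)) ≡ prependRun a (runs A′) ++ runs (b ∷ B)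
  prepend-split [] with runs-nonempty b B
  ... | r′ , rs , eq rewrite eq | <ᵇ-false b≤a = refl
  prepend-split (a′ ∷ A′) with runs-nonempty a′ A′
  ... | r′ , rs , eq rewrite eq with a <ᵇ a′
  ...   | true  = refl
  ...   | false = refl

runs-interval : ∀ s c → runs (interval s (suc c)) ≡ interval s (suc c) ∷ []
runs-interval s zero    = refl
runs-interval s (suc c) = begin
  runs (s ∷ interval (suc s) (suc c))               ≡⟨ runs-∷ s (interval (suc s) (suc c)) ⟩
  prependRun s (runs (interval (suc s) (suc c)))    ≡⟨ cong (prependRun s) (runs-interval (suc s) c) ⟩
  prependRun s (interval (suc s) (suc c) ∷ [])      ≡⟨ cong (λ b → if b then interval s (suc (suc c)) ∷ [] else (s ∷ []) ∷ interval (suc s) (suc c) ∷ []) (<ᵇ-true (n<1+n s)) ⟩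
  interval s (suc (suc c)) ∷ []                     ∎
  where open ≡-Reasoning

consecutive-interval : ∀ s c → Consecutive (interval s c)
consecutive-interval s zero          = _
consecutive-interval s (suc zero)    = _
consecutive-interval s (suc (suc c)) = refl , consecutive-interval (suc s) (suc c)

minL-interval : ∀ s c → minL (interval s (suc c)) ≡ s
minL-interval s c = foldr-⊓ (interval (suc s) c) (All.map (λ (s<y , _) → <⇒≤ s<y) (interval-bounds (suc s) c))
  where
  foldr-⊓ : ∀ L → All (s ≤_) L → foldr _⊓_ s L ≡ s
  foldr-⊓ []      []          = refl
  foldr-⊓ (y ∷ L) (s≤y ∷ s≤L) = trans (cong (y ⊓_) (foldr-⊓ L s≤L)) (m≥n⇒m⊓n≡n s≤y)

SuperYamanouchiAbove : ℕ → List ℕ → Set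
SuperYamanouchiAbove p ρ = SuperYamanouchi ρ × All (p <_) (map minL (runs ρ))

linked-snoc : ∀ {xs y} → Linked _>_ xs → All (y <_) xs → Linked _>_ (xs ++ y ∷ [])
linked-snoc []          []            = [-]
linked-snoc [-]         (y<x ∷ [])    = y<x ∷ [-]
linked-snoc (x>x′ ∷ xs) (_ ∷ y<xs)    = x>x′ ∷ linked-snoc xs y<xs

-- Appending a run [p+1, p+1+c] below all letters of a super-Yamanouchi word keeps it
-- super-Yamanouchi: the new run is last and has the smallest minimum.
append-run : ∀ p ρ c → All (suc p <_) ρ → SuperYamanouchiAbove (suc p) ρ →
             SuperYamanouchiAbove p (ρ ++ interval (suc p) (suc c))
append-run p ρ c ρ-above ((consecutive , decreasing) , mins-above) =
  (subst (All Consecutive) (sym runs≡) (All.++⁺ consecutive (consecutive-interval (suc p) (suc c) ∷ [])) ,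
   subst (Linked _>_) (sym mins≡) (linked-snoc decreasing mins-above)) ,
  subst (All (p <_)) (sym mins≡) (All.++⁺ (All.map <⇒≤ mins-above) (n<1+n p ∷ []))
  where
  I = interval (suc p) (suc c)
  runs≡ : runs (ρ ++ I) ≡ runs ρ ++ I ∷ []
  runs≡ = trans (runs-++ ρ (suc p) (interval (suc (suc p)) c) (All.map <⇒≤ ρ-above))
                (cong (runs ρ ++_) (runs-interval (suc p) c))
  mins≡ : map minL (runs (ρ ++ I)) ≡ map minL (runs ρ) ++ suc p ∷ []
  mins≡ = trans (cong (map minL) runs≡)
                (trans (List.map-++ minL (runs ρ) (I ∷ [])) (cong (λ m → map minL (runs ρ) ++ m ∷ []) (minL-interval (suc p) c)))

-- The word of any code is super-Yamanouchi: its rows are runs of consecutive letters whose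
-- first letters p+m > … > p+2 > p+1 decrease (empty rows are skipped).
codeWord-superYamanouchi : ∀ p cs → SuperYamanouchiAbove p (codeWord p cs)
codeWord-superYamanouchi p []             = ([] , []) , []
codeWord-superYamanouchi p (zero ∷ cs)    =
  subst (SuperYamanouchiAbove p) (sym (List.++-identityʳ (codeWord (suc p) cs)))
        (proj₁ rest , All.map <⇒≤ (proj₂ rest))
  where rest = codeWord-superYamanouchi (suc p) cs
codeWord-superYamanouchi p (suc c ∷ cs) =
  append-run p (codeWord (suc p) cs) c (codeWord-above (suc p) cs) (codeWord-superYamanouchi (suc p) cs)

length-idPerm : ∀ n → length (idPerm n) ≡ n
length-idPerm n = trans (cong length (range1≡interval n)) (length-interval 1 n)

proposition3p4 : (n : ℕ) (w : List ℕ) → w ↭ idPerm n →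
    IsReducedWord n w (rowReadingWord w) × SuperYamanouchi (rowReadingWord w)
proposition3p4 n w w↭id with trans (↭-length w↭id) (length-idPerm n)
... | refl = subst (λ ρ → IsReducedWord n w ρ × SuperYamanouchi ρ) (sym reading≡codeWord)
                   ((letters , produces-w , length≡ℓ) , proj₁ (codeWord-superYamanouchi 0 cs))
  where
  cs = lehmerCode w
  w↭[1,n] : w ↭ interval 1 n
  w↭[1,n] = subst (w ↭_) (range1≡interval n) w↭id

  uniq : Unique w
  uniq = Permutationₛ.Unique-resp-↭ (setoid ℕ) (↭⇒↭ₛ (↭-sym w↭[1,n])) (AllPairs.map <⇒≢ (interval-sorted 1 n))

  reading≡codeWord : rowReadingWord w ≡ codeWord 0 cs
  reading≡codeWord = rowReadingWord≡codeWord w uniq (All-resp-↭ (↭-sym w↭[1,n]) (interval-bounds 1 n))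

  letters : All (λ r → 1 ≤ r × r < n) (codeWord 0 cs)
  letters = All.zip (codeWord-above 0 cs , lehmerWord-below 0 w)

  produces-w : act (codeWord 0 cs) (idPerm n) ≡ w
  produces-w = trans (cong (act (codeWord 0 cs)) (range1≡interval n))
                     (act-codeWord w (interval 1 n) (interval-sorted 1 n) w↭[1,n])

  length≡ℓ : length (codeWord 0 cs) ≡ inversions w
  length≡ℓ = trans (length-codeWord 0 cs) (sym (inversions≡sum-lehmerCode w))
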